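{- Let $T=(\Sigma,\mathcal{R})$ be a graph transformation system and $\mathcal{D}\subseteq\mathcal{G}(\Sigma)$ a graph language. If $T$ has no $\mathcal{D}$-non-garbage critical pairs, then $T$ is subcommutative up to garbage on $\mathcal{D}$.
   Context: A signature $\Sigma=(\Sigma_V,\Sigma_E)$ is a pair of finite label sets; graphs over $\Sigma$ are finite directed graphs with node labels in $\Sigma_V$ and edge labels in $\Sigma_E$; $\mathcal{G}(\Sigma)$ is the class of all of them. A graph language is an isomorphism-closed class of graphs; $\widehat{\mathcal{D}}$ is the smallest language containing $\mathcal{D}$ that is closed under taking subgraphs. A rule is a pair of inclusions $r=\langle L\leftarrow K\rightarrow R\rangle$; a GT system $T=(\Sigma,\mathcal{R})$ has a finite rule set. A direct derivation $G\Rightarrow_{r,g}H$ applies $r$ at an injective match $g:L\to G$ via a double pushout. $G\Rightarrow^=_\mathcal{R}H$ means $G\cong H$ or $G\Rightarrow_\mathcal{R}H$. Direct derivations $H_1\Leftarrow_{r_1,g_1}G\Rightarrow_{r_2,g_2}H_2$ are parallelly independent if $g_1(L_1)\cap g_2(L_2)\subseteq g_1(K_1)\cap g_2(K_2)$; they form a critical pair if not parallelly independent, $G=g_1(L_1)\cup g_2(L_2)$, and $g_1\neq g_2$ when $r_1=r_2$; the critical pair is $\mathcal{D}$-non-garbage if $G\in\widehat{\mathcal{D}}$. $T$ is subcommutative up to garbage on $\mathcal{D}$ if for all $G\in\mathcal{D}$, $H_1\Leftarrow_\mathcal{R}G\Rightarrow_\mathcal{R}H_2$ implies there is $M$ with $H_1\Rightarrow^=_\mathcal{R}M\Leftarrow^=_\mathcal{R}H_2$.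 -}

module Defs where

open import Level using (Level) renaming (suc to lsuc; zero to lzero)
open import Data.Nat using (ℕ)
open import Data.Fin using (Fin)
open import Data.Product using (Σ; ∃; _×_; _,_)
open import Data.Sum using (_⊎_)
open import Relation.Binary.PropositionalEquality using (_≡_; refl; trans; cong; sym)
open import Relation.Nullary using (¬_)
open import Function using (_∘_)
open import Function.Definitions using (Injective)

-- Signatures: finite label sets  Σ_V = Fin nV,  Σ_E = Fin nE

record Signature : Set where
  field
    nV nE : ℕ

record Graph (S : Signature) : Set where
  field
    V E  : ℕ
    src  : Fin E → Fin V
    tgt  : Fin E → Fin V
    lblV : Fin V → Fin (Signature.nV S)
    lblE : Fin E → Fin (Signature.nE S)

open Graph

record Hom {S : Signature} (G H : Graph S) : Set where
  field
    hV : Fin (V G) → Fin (V H)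
    hE : Fin (E G) → Fin (E H)
    src-pres  : ∀ e → hV (src G e) ≡ src H (hE e)
    tgt-pres  : ∀ e → hV (tgt G e) ≡ tgt H (hE e)
    lblV-pres : ∀ v → lblV H (hV v) ≡ lblV G v
    lblE-pres : ∀ e → lblE H (hE e) ≡ lblE G e

open Hom

module _ {S : Signature} where

  idH : {G : Graph S} → Hom G G
  idH = record
    { hV = λ v → v ; hE = λ e → e
    ; src-pres = λ _ → refl ; tgt-pres = λ _ → refl
    ; lblV-pres = λ _ → refl ; lblE-pres = λ _ → refl }

  infixr 9 _∘H_
  _∘H_ : {A B C : Graph S} → Hom B C → Hom A B → Hom A C
  g ∘H f = record
    { hV = hV g ∘ hV f
    ; hE = hE g ∘ hE f
    ; src-pres = λ e → trans (cong (hV g) (src-pres f e)) (src-pres g (hE f e))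
    ; tgt-pres = λ e → trans (cong (hV g) (tgt-pres f e)) (tgt-pres g (hE f e))
    ; lblV-pres = λ v → trans (lblV-pres g (hV f v)) (lblV-pres f v)
    ; lblE-pres = λ e → trans (lblE-pres g (hE f e)) (lblE-pres f e) }

  infix 4 _≈H_
  _≈H_ : {A B : Graph S} → Hom A B → Hom A B → Set
  f ≈H g = (∀ v → hV f v ≡ hV g v) × (∀ e → hE f e ≡ hE g e)

  InjectiveH : {A B : Graph S} → Hom A B → Set
  InjectiveH f = Injective _≡_ _≡_ (hV f) × Injective _≡_ _≡_ (hE f)

  _≅_ : Graph S → Graph S → Set
  G ≅ H = Σ (Hom G H) λ f → Σ (Hom H G) λ g → ((g ∘H f) ≈H idH) × ((f ∘H g) ≈H idH)

  record IsPushout {A B C P : Graph S}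
                   (f : Hom A B) (g : Hom A C) (i : Hom B P) (j : Hom C P) : Set where
    field
      commutes  : (i ∘H f) ≈H (j ∘H g)
      universal : ∀ (Q : Graph S) (b : Hom B Q) (c : Hom C Q) → (b ∘H f) ≈H (c ∘H g) →
                  Σ (Hom P Q) λ u → ((u ∘H i) ≈H b) × ((u ∘H j) ≈H c) ×
                    (∀ (u' : Hom P Q) → (u' ∘H i) ≈H b → (u' ∘H j) ≈H c → u' ≈H u)

  -- Rules  L ← K → R  (pair of inclusions = injective morphisms)

  record Rule : Set where
    field
      L K R : Graph S
      l     : Hom K L
      r     : Hom K R
      l-inj : InjectiveH l
      r-inj : InjectiveH r

  open Rule

  record DirectDerivation (ρ : Rule) {G : Graph S} (g : Hom (L ρ) G) (H : Graph S) : Set where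
    field
      match-inj : InjectiveH g
      D   : Graph S
      k   : Hom (K ρ) D
      d   : Hom D G
      h   : Hom (R ρ) H
      e   : Hom D H
      po₁ : IsPushout (l ρ) k g d
      po₂ : IsPushout (r ρ) k h e

  InImgV : {A G : Graph S} → Hom A G → Fin (V G) → Set
  InImgV f v = ∃ λ x → hV f x ≡ v

  InImgE : {A G : Graph S} → Hom A G → Fin (E G) → Set
  InImgE f e = ∃ λ x → hE f x ≡ e

  ParallelIndependent : (ρ₁ ρ₂ : Rule) {G : Graph S} → Hom (L ρ₁) G → Hom (L ρ₂) G → Set
  ParallelIndependent ρ₁ ρ₂ g₁ g₂ =
    (∀ v → InImgV g₁ v → InImgV g₂ v → InImgV (g₁ ∘H l ρ₁) v × InImgV (g₂ ∘H l ρ₂) v) ×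
    (∀ e → InImgE g₁ e → InImgE g₂ e → InImgE (g₁ ∘H l ρ₁) e × InImgE (g₂ ∘H l ρ₂) e)

  JointlyCover : {A B G : Graph S} → Hom A G → Hom B G → Set
  JointlyCover g₁ g₂ = (∀ v → InImgV g₁ v ⊎ InImgV g₂ v) × (∀ e → InImgE g₁ e ⊎ InImgE g₂ e)

  IsoClosed : (Graph S → Set) → Set
  IsoClosed P = ∀ {G H} → G ≅ H → P G → P H

  -- closed under taking subgraphs (a subgraph of G is, up to iso,
  -- the domain of an injective morphism into G)
  SubgraphClosed : (Graph S → Set) → Set
  SubgraphClosed P = ∀ {G H} (f : Hom H G) → InjectiveH f → P G → P H

  Hat : (Graph S → Set) → Graph S → Set₁
  Hat D G = ∀ (P : Graph S → Set) → IsoClosed P → SubgraphClosed P →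
            (∀ H → D H → P H) → P G

record GTS : Set where
  field
    sig   : Signature
    n     : ℕ
    rule  : Fin n → Rule {sig}

module _ (T : GTS) where
  open GTS T
  open Rule

  Step : Graph sig → Graph sig → Set
  Step G H = Σ (Fin n) λ i → Σ (Hom (L (rule i)) G) λ g → DirectDerivation (rule i) g H

  StepEq : Graph sig → Graph sig → Set
  StepEq G H = (G ≅ H) ⊎ Step G H

  SameMatch : {G : Graph sig} {i j : Fin n} → i ≡ j →
              Hom (L (rule i)) G → Hom (L (rule j)) G → Set
  SameMatch refl g₁ g₂ = g₁ ≈H g₂

  record IsCriticalPair {G H₁ H₂ : Graph sig} (i₁ i₂ : Fin n)
         (g₁ : Hom (L (rule i₁)) G) (g₂ : Hom (L (rule i₂)) G)
         (d₁ : DirectDerivation (rule i₁) g₁ H₁)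
         (d₂ : DirectDerivation (rule i₂) g₂ H₂) : Set where
    field
      not-independent : ¬ ParallelIndependent (rule i₁) (rule i₂) g₁ g₂
      covers          : JointlyCover g₁ g₂
      distinct        : (p : i₁ ≡ i₂) → ¬ SameMatch p g₁ g₂

  NoNonGarbageCriticalPairs : (Graph sig → Set) → Set₁
  NoNonGarbageCriticalPairs D =
    ∀ {G H₁ H₂ : Graph sig} (i₁ i₂ : Fin n)
      (g₁ : Hom (L (rule i₁)) G) (g₂ : Hom (L (rule i₂)) G)
      (d₁ : DirectDerivation (rule i₁) g₁ H₁)
      (d₂ : DirectDerivation (rule i₂) g₂ H₂) →
      IsCriticalPair i₁ i₂ g₁ g₂ d₁ d₂ → ¬ Hat D G

  SubcommutativeUpToGarbage : (Graph sig → Set) → Set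
  SubcommutativeUpToGarbage D =
    ∀ (G : Graph sig) → D G → ∀ H₁ H₂ → Step G H₁ → Step G H₂ →
      Σ (Graph sig) λ M → StepEq H₁ M × StepEq H₂ M

-- Take two steps H₁ ⇐ G ⇒ H₂ with G ∈ D. If they are parallel independent, the Local Church–Rosser
-- construction joins them in one step each: each match survives in the other step's context, and both
-- rules are applied to the intersection N of the two contexts. Otherwise restrict both steps to the
-- subgraph G₀ = g₁(L₁) ∪ g₂(L₂) of G: they remain steps, still overlap outside their interfaces and
-- cover G₀, so unless they apply the same rule at the same match they form a critical pair, which is
-- non-garbage because G₀ is a subgraph of G ∈ D. In that last case H₁ ≅ H₂, since a step is determined
-- up to isomorphism by its rule and match.
--
-- All pushouts involved are along injective morphisms; these are described explicitly, componentwise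
-- on vertices and edges, and restriction and gluing are argued on that description.

module Submission where

open import Defs
open Graph
open Hom
open import Data.Nat using (ℕ; zero; suc; _+_)
open import Data.Fin using (Fin; zero; suc; _↑ˡ_; _↑ʳ_; splitAt)
open import Data.Fin.Properties
  using (any?; all?; suc-injective; ↑ˡ-injective; ↑ʳ-injective; splitAt-↑ˡ; splitAt-↑ʳ; splitAt⁻¹-↑ˡ; splitAt⁻¹-↑ʳ)
  renaming (_≟_ to _≟ᶠ_)
open import Data.Product using (Σ; ∃; _×_; _,_; proj₁; proj₂)
open import Data.Sum using (_⊎_; inj₁; inj₂; [_,_]′)
import Data.Sum as Sum
open import Data.Empty using (⊥-elim)
open import Function using (_∘_)
open import Function.Definitions using (Injective)
open import Relation.Binary.PropositionalEquality
open import Relation.Nullary using (¬_; Dec; yes; no)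
open import Relation.Nullary.Decidable using (¬?; map′; _×-dec_; _⊎-dec_; _→-dec_)
open import Relation.Unary using (Decidable)
open import Relation.Binary.Bundles using (Setoid)
import Relation.Binary.Reasoning.Setoid as SetoidReasoning
open import Level using (0ℓ)

-- Finite sets

Img : ∀ {m n} → (Fin m → Fin n) → Fin n → Set
Img f y = ∃ λ x → f x ≡ y

img? : ∀ {m n} (f : Fin m → Fin n) → Decidable (Img f)
img? f y = any? (λ x → f x ≟ᶠ y)

record Enumeration {n : ℕ} (P : Fin n → Set) : Set where
  field
    size           : ℕ
    elem           : Fin size → Fin n
    elem-injective : Injective _≡_ _≡_ elem
    elem-∈         : ∀ j → P (elem j)
    index          : ∀ x → P x → Fin size
    elem-index     : ∀ x p → elem (index x p) ≡ x

  index-elem : ∀ j p → index (elem j) p ≡ j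
  index-elem j p = elem-injective (elem-index (elem j) p)

  index-irrelevant : ∀ x p q → index x p ≡ index x q
  index-irrelevant x p q = elem-injective (trans (elem-index x p) (sym (elem-index x q)))

enumerate : ∀ {n} {P : Fin n → Set} → Decidable P → Enumeration P
enumerate {zero} _ = record
  { size = 0 ; elem = λ () ; elem-injective = λ { {()} } ; elem-∈ = λ ()
  ; index = λ () ; elem-index = λ () }
enumerate {suc n} {P} P? with P? zero
... | yes p₀ = record
  { size = suc size ; elem = elem₀ ; elem-injective = elem₀-injective ; elem-∈ = elem₀-∈
  ; index = index₀ ; elem-index = elem₀-index₀ }
  where
  open Enumeration (enumerate (P? ∘ suc))
  elem₀ : Fin (suc size) → Fin (suc n)
  elem₀ zero    = zero
  elem₀ (suc j) = suc (elem j)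
  elem₀-injective : Injective _≡_ _≡_ elem₀
  elem₀-injective {zero}  {zero}  _ = refl
  elem₀-injective {suc _} {suc _} q = cong suc (elem-injective (suc-injective q))
  elem₀-∈ : ∀ j → P (elem₀ j)
  elem₀-∈ zero    = p₀
  elem₀-∈ (suc j) = elem-∈ j
  index₀ : ∀ x → P x → Fin (suc size)
  index₀ zero    _ = zero
  index₀ (suc x) p = suc (index x p)
  elem₀-index₀ : ∀ x p → elem₀ (index₀ x p) ≡ x
  elem₀-index₀ zero    _ = refl
  elem₀-index₀ (suc x) p = cong suc (elem-index x p)
... | no ¬p₀ = record
  { size = size ; elem = suc ∘ elem ; elem-injective = elem-injective ∘ suc-injective
  ; elem-∈ = elem-∈ ; index = index₀ ; elem-index = elem-index₀ }
  where
  open Enumeration (enumerate (P? ∘ suc))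
  index₀ : ∀ x → P x → Fin size
  index₀ zero    p = ⊥-elim (¬p₀ p)
  index₀ (suc x) p = index x p
  elem-index₀ : ∀ x p → suc (elem (index₀ x p)) ≡ x
  elem-index₀ zero    p = ⊥-elim (¬p₀ p)
  elem-index₀ (suc x) p = cong suc (elem-index x p)

-- Pushouts of finite sets along injections

-- For injective f, this characterises pushouts of finite sets: P is the disjoint union of j(C)
-- and an injective copy i(B ∖ f(A)), and i agrees with j ∘ g on f(A).
record IsSetPushout {A B C P : ℕ} (f : Fin A → Fin B) (g : Fin A → Fin C)
                    (i : Fin B → Fin P) (j : Fin C → Fin P) : Set where
  field
    commutes            : ∀ a → i (f a) ≡ j (g a)
    j-injective         : Injective _≡_ _≡_ j
    covers              : ∀ p → Img j p ⊎ ∃ λ b → ¬ Img f b × i b ≡ p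
    overlap-in-image    : ∀ b c → i b ≡ j c → Img f b
    i-injective-outside : ∀ b b' → ¬ Img f b → i b ≡ i b' → b ≡ b'

  elim : (Φ : Fin P → Set) → (∀ c → Φ (j c)) → (∀ b → Φ (i b)) → ∀ p → Φ p
  elim Φ Φj Φi p with covers p
  ... | inj₁ (c , refl)     = Φj c
  ... | inj₂ (b , _ , refl) = Φi b

  module Copair {Q : Set} (β : Fin B → Q) (γ : Fin C → Q) (βf≡γg : ∀ a → β (f a) ≡ γ (g a)) where
    copair : Fin P → Q
    copair p with covers p
    ... | inj₁ (c , _) = γ c
    ... | inj₂ (b , _) = β b

    copair-j : ∀ c → copair (j c) ≡ γ c
    copair-j c with covers (j c)
    ... | inj₁ (c' , jc'≡jc)     = cong γ (j-injective jc'≡jc)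
    ... | inj₂ (b , b∉f , ib≡jc) = ⊥-elim (b∉f (overlap-in-image b c ib≡jc))

    copair-i : ∀ b → copair (i b) ≡ β b
    copair-i b with covers (i b)
    ... | inj₂ (b' , b'∉f , ib'≡ib) = cong β (i-injective-outside b' b b'∉f ib'≡ib)
    ... | inj₁ (c , jc≡ib) with overlap-in-image b c (sym jc≡ib)
    ...   | a , refl = begin
      γ c         ≡⟨ cong γ (j-injective (trans jc≡ib (commutes a))) ⟩
      γ (g a)     ≡⟨ βf≡γg a ⟨
      β (f a)     ∎
      where open ≡-Reasoning

IsSetPushout-transport :
  ∀ {A B C P₀ P} {f : Fin A → Fin B} {g : Fin A → Fin C}
    {i₀ : Fin B → Fin P₀} {j₀ : Fin C → Fin P₀} {i : Fin B → Fin P} {j : Fin C → Fin P} →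
  IsSetPushout f g i₀ j₀ → (v : Fin P₀ → Fin P) (u : Fin P → Fin P₀) →
  (∀ p → v (u p) ≡ p) → (∀ p → u (v p) ≡ p) → (∀ b → v (i₀ b) ≡ i b) → (∀ c → v (j₀ c) ≡ j c) →
  IsSetPushout f g i j
IsSetPushout-transport {f = f} {g} {i₀} {j₀} {i} {j} po v u vu≗id uv≗id vi₀≗i vj₀≗j = record
  { commutes            = λ a → trans (sym (vi₀≗i (f a))) (trans (cong v (commutes a)) (vj₀≗j (g a)))
  ; j-injective         = λ {c} {c'} e → j-injective (v-injective (trans (vj₀≗j c) (trans e (sym (vj₀≗j c')))))
  ; covers              = covers′
  ; overlap-in-image    = λ b c e → overlap-in-image b c (v-injective (trans (vi₀≗i b) (trans e (sym (vj₀≗j c)))))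
  ; i-injective-outside = λ b b' b∉f e →
      i-injective-outside b b' b∉f (v-injective (trans (vi₀≗i b) (trans e (sym (vi₀≗i b'))))) }
  where
  open IsSetPushout po
  v-injective : Injective _≡_ _≡_ v
  v-injective {x} {y} e = trans (sym (uv≗id x)) (trans (cong u e) (uv≗id y))
  covers′ : ∀ p → Img j p ⊎ ∃ λ b → ¬ Img f b × i b ≡ p
  covers′ p with covers (u p)
  ... | inj₁ (c , e)        = inj₁ (c , trans (sym (vj₀≗j c)) (trans (cong v e) (vu≗id p)))
  ... | inj₂ (b , b∉f , e)  = inj₂ (b , b∉f , trans (sym (vi₀≗i b)) (trans (cong v e) (vu≗id p)))

-- The standard pushout along an injective f: P = C + |B ∖ f(A)|.
module SetPushout {A B C : ℕ} (f : Fin A → Fin B) (f-injective : Injective _≡_ _≡_ f) (g : Fin A → Fin C) where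
  open Enumeration (enumerate (λ b → ¬? (img? f b))) public

  P : ℕ
  P = C + size

  j : Fin C → Fin P
  j c = c ↑ˡ size

  i-by-cases : ∀ b → Dec (Img f b) → Fin P
  i-by-cases b (yes (a , _)) = j (g a)
  i-by-cases b (no b∉f)      = C ↑ʳ index b b∉f

  i : Fin B → Fin P
  i b = i-by-cases b (img? f b)

  i-elim : (Φ : Fin P → Fin B → Set) → (∀ a → Φ (j (g a)) (f a)) → (∀ b b∉f → Φ (C ↑ʳ index b b∉f) b) →
           ∀ b → Φ (i b) b
  i-elim Φ Φf Φ∉f b with img? f b
  ... | yes (a , refl) = Φf a
  ... | no b∉f         = Φ∉f b b∉f

  i-image : ∀ a → i (f a) ≡ j (g a)
  i-image a with img? f (f a)
  ... | yes (a' , fa'≡fa) = cong (j ∘ g) (f-injective fa'≡fa)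
  ... | no fa∉f           = ⊥-elim (fa∉f (a , refl))

  i-outside : ∀ b (b∉f : ¬ Img f b) → i b ≡ C ↑ʳ index b b∉f
  i-outside b b∉f with img? f b
  ... | yes b∈f   = ⊥-elim (b∉f b∈f)
  ... | no b∉f'   = cong (C ↑ʳ_) (index-irrelevant b b∉f' b∉f)

  ↑ʳ≢↑ˡ : ∀ x c → C ↑ʳ x ≢ c ↑ˡ size
  ↑ʳ≢↑ˡ x c e with trans (sym (splitAt-↑ʳ C size x)) (trans (cong (splitAt C) e) (splitAt-↑ˡ C c size))
  ... | ()

  isSetPushout : IsSetPushout f g i j
  isSetPushout = record
    { commutes            = i-image
    ; j-injective         = λ {c} {c'} → ↑ˡ-injective size c c'
    ; covers              = covers
    ; overlap-in-image    = overlap-in-image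
    ; i-injective-outside = i-injective-outside }
    where
    covers : ∀ p → Img j p ⊎ ∃ λ b → ¬ Img f b × i b ≡ p
    covers p with splitAt C p in eq
    ... | inj₁ c = inj₁ (c , splitAt⁻¹-↑ˡ eq)
    ... | inj₂ t = inj₂ (elem t , elem-∈ t , (begin
      i (elem t)                      ≡⟨ i-outside (elem t) (elem-∈ t) ⟩
      C ↑ʳ index (elem t) (elem-∈ t)  ≡⟨ cong (C ↑ʳ_) (index-elem t _) ⟩
      C ↑ʳ t                          ≡⟨ splitAt⁻¹-↑ʳ eq ⟩
      p                               ∎))
      where open ≡-Reasoning
    overlap-in-image : ∀ b c → i b ≡ j c → Img f b
    overlap-in-image b c e with img? f b
    ... | yes b∈f = b∈f
    ... | no _    = ⊥-elim (↑ʳ≢↑ˡ _ c e)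
    i-injective-outside : ∀ b b' → ¬ Img f b → i b ≡ i b' → b ≡ b'
    i-injective-outside b b' b∉f e with img? f b'
    ... | yes (a , _) = ⊥-elim (↑ʳ≢↑ˡ _ (g a) (trans (sym (i-outside b b∉f)) e))
    ... | no b'∉f     = begin
      b                      ≡⟨ elem-index b b∉f ⟨
      elem (index b b∉f)     ≡⟨ cong elem (↑ʳ-injective C _ _ (trans (sym (i-outside b b∉f)) e)) ⟩
      elem (index b' b'∉f)   ≡⟨ elem-index b' b'∉f ⟩
      b'                     ∎
      where open ≡-Reasoning

-- Restricting a pushout along an injective m : G' → G that contains the image of g,
-- where n : N → D is the part of D lying over G'.
IsSetPushout-restrict :
  ∀ {K L D G G' N} {l : Fin K → Fin L} {k : Fin K → Fin D} {g : Fin L → Fin G} {d : Fin D → Fin G}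
    {m : Fin G' → Fin G} {g' : Fin L → Fin G'} {n : Fin N → Fin D} {k' : Fin K → Fin N} {d' : Fin N → Fin G'} →
  IsSetPushout l k g d → Injective _≡_ _≡_ g → Injective _≡_ _≡_ m → Injective _≡_ _≡_ n →
  (∀ x → m (g' x) ≡ g x) → (∀ a → n (k' a) ≡ k a) → (∀ z → m (d' z) ≡ d (n z)) →
  (∀ x → Img m (d x) → Img n x) →
  IsSetPushout l k' g' d'
IsSetPushout-restrict {l = l} {k} {g} {d} {m} {g'} {n} {k'} {d'}
                      po g-injective m-injective n-injective mg'≗g nk'≗k md'≗dn over-m⇒in-n = record
  { commutes            = λ a → m-injective (begin
      m (g' (l a))   ≡⟨ mg'≗g (l a) ⟩
      g (l a)        ≡⟨ commutes a ⟩
      d (k a)        ≡⟨ cong d (nk'≗k a) ⟨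
      d (n (k' a))   ≡⟨ md'≗dn (k' a) ⟨
      m (d' (k' a))  ∎)
  ; j-injective         = λ {z} {z'} e → n-injective (j-injective (trans (sym (md'≗dn z)) (trans (cong m e) (md'≗dn z'))))
  ; covers              = covers′
  ; overlap-in-image    = λ b z e → overlap-in-image b (n z) (trans (sym (mg'≗g b)) (trans (cong m e) (md'≗dn z)))
  ; i-injective-outside = λ b b' _ e → g-injective (trans (sym (mg'≗g b)) (trans (cong m e) (mg'≗g b'))) }
  where
  open IsSetPushout po
  open ≡-Reasoning
  covers′ : ∀ q → Img d' q ⊎ ∃ λ b → ¬ Img l b × g' b ≡ q
  covers′ q with covers (m q)
  ... | inj₂ (b , b∉l , gb≡mq) = inj₂ (b , b∉l , m-injective (trans (mg'≗g b) gb≡mq))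
  ... | inj₁ (x , dx≡mq) with over-m⇒in-n x (q , sym dx≡mq)
  ...   | z , refl = inj₁ (z , m-injective (trans (md'≗dn z) dx≡mq))

pushoutComplement-image-⊆ :
  ∀ {K L D₁ D₂ G} {l : Fin K → Fin L} {k₁ : Fin K → Fin D₁} {k₂ : Fin K → Fin D₂} {g₁ g₂ : Fin L → Fin G}
    {d₁ : Fin D₁ → Fin G} {d₂ : Fin D₂ → Fin G} →
  IsSetPushout l k₁ g₁ d₁ → IsSetPushout l k₂ g₂ d₂ → (∀ x → g₁ x ≡ g₂ x) → ∀ x → Img d₂ (d₁ x)
pushoutComplement-image-⊆ {d₁ = d₁} po₁ po₂ g₁≗g₂ x with IsSetPushout.covers po₂ (d₁ x)
... | inj₁ d₁x∈d₂          = d₁x∈d₂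
... | inj₂ (b , b∉l , e)   = ⊥-elim (b∉l (IsSetPushout.overlap-in-image po₁ b x (trans (g₁≗g₂ b) e)))

IsSetPushout-⊆context : ∀ {K L D G} {l : Fin K → Fin L} {k : Fin K → Fin D} {g : Fin L → Fin G} {d : Fin D → Fin G} →
                        IsSetPushout l k g d → Injective _≡_ _≡_ g →
                        ∀ v → (Img g v → Img (g ∘ l) v) → Img d v
IsSetPushout-⊆context po g-injective v only-through-interface with IsSetPushout.covers po v
... | inj₁ v∈d                = v∈d
... | inj₂ (b , b∉l , gb≡v)  with only-through-interface (b , gb≡v)
...   | a , gla≡v             = ⊥-elim (b∉l (a , g-injective (trans gla≡v (sym gb≡v))))

Img-cancel : ∀ {L G G'} {g : Fin L → Fin G} {m : Fin G' → Fin G} {g' : Fin L → Fin G'} →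
             Injective _≡_ _≡_ m → (∀ x → m (g' x) ≡ g x) → ∀ q → Img g (m q) → Img g' q
Img-cancel m-injective mg'≗g q (a , ga≡mq) = a , m-injective (trans (mg'≗g a) ga≡mq)

independent-restrict :
  ∀ {K₁ K₂ L₁ L₂ G G'} {l₁ : Fin K₁ → Fin L₁} {l₂ : Fin K₂ → Fin L₂} {g₁ : Fin L₁ → Fin G} {g₂ : Fin L₂ → Fin G}
    {m : Fin G' → Fin G} {g₁' : Fin L₁ → Fin G'} {g₂' : Fin L₂ → Fin G'} →
  Injective _≡_ _≡_ m → (∀ x → m (g₁' x) ≡ g₁ x) → (∀ x → m (g₂' x) ≡ g₂ x) →
  (∀ q → Img g₁' q → Img g₂' q → Img (g₁' ∘ l₁) q × Img (g₂' ∘ l₂) q) →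
  (∀ v → Img g₁ v → Img g₂ v → Img (g₁ ∘ l₁) v × Img (g₂ ∘ l₂) v)
independent-restrict {g₂ = g₂} {m} {g₁'} m-injective mg₁'≗g₁ mg₂'≗g₂ independent′ v (a , refl) v∈g₂
  with independent′ (g₁' a) (a , refl) (Img-cancel m-injective mg₂'≗g₂ (g₁' a) (subst (Img g₂) (sym (mg₁'≗g₁ a)) v∈g₂))
... | (c₁ , g₁'l₁c₁≡q) , (c₂ , g₂'l₂c₂≡q) =
  (c₁ , trans (sym (mg₁'≗g₁ _)) (trans (cong m g₁'l₁c₁≡q) (mg₁'≗g₁ a))) ,
  (c₂ , trans (sym (mg₂'≗g₂ _)) (trans (cong m g₂'l₂c₂≡q) (mg₁'≗g₁ a)))

-- Graph morphisms

-- f ≈H g unfolds to (hV f ≗ hV g) × (hE f ≗ hE g), from which Agda cannot recover f and g.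
-- Stating the algebra of ≈H for such pairs of functions lets every implicit argument be inferred.
≈H-refl : ∀ {a b c d} {fV : Fin a → Fin b} {fE : Fin c → Fin d} → (fV ≗ fV) × (fE ≗ fE)
≈H-refl = (λ _ → refl) , (λ _ → refl)

≈H-sym : ∀ {a b c d} {fV gV : Fin a → Fin b} {fE gE : Fin c → Fin d} →
         (fV ≗ gV) × (fE ≗ gE) → (gV ≗ fV) × (gE ≗ fE)
≈H-sym (p , q) = (λ v → sym (p v)) , (λ e → sym (q e))

≈H-trans : ∀ {a b c d} {fV gV iV : Fin a → Fin b} {fE gE iE : Fin c → Fin d} →
           (fV ≗ gV) × (fE ≗ gE) → (gV ≗ iV) × (gE ≗ iE) → (fV ≗ iV) × (fE ≗ iE)
≈H-trans (p , q) (p' , q') = (λ v → trans (p v) (p' v)) , (λ e → trans (q e) (q' e))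

∘H-injective : ∀ {a b c d e f} {fV : Fin b → Fin c} {gV : Fin a → Fin b} {fE : Fin e → Fin f} {gE : Fin d → Fin e} →
               Injective _≡_ _≡_ fV × Injective _≡_ _≡_ fE → Injective _≡_ _≡_ gV × Injective _≡_ _≡_ gE →
               Injective _≡_ _≡_ (fV ∘ gV) × Injective _≡_ _≡_ (fE ∘ gE)
∘H-injective (fV-inj , fE-inj) (gV-inj , gE-inj) = gV-inj ∘ fV-inj , gE-inj ∘ fE-inj

module _ {S : Signature} where

  ∘H-congˡ : ∀ {a e} {B C : Graph S} (h : Hom B C) {fV gV : Fin a → Fin (V B)} {fE gE : Fin e → Fin (E B)} →
             (fV ≗ gV) × (fE ≗ gE) → (hV h ∘ fV ≗ hV h ∘ gV) × (hE h ∘ fE ≗ hE h ∘ gE)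
  ∘H-congˡ h (p , q) = (λ v → cong (hV h) (p v)) , (λ e → cong (hE h) (q e))

  ∘H-congʳ : ∀ {c d} {A B : Graph S} (h : Hom A B) {fV gV : Fin (V B) → Fin c} {fE gE : Fin (E B) → Fin d} →
             (fV ≗ gV) × (fE ≗ gE) → (fV ∘ hV h ≗ gV ∘ hV h) × (fE ∘ hE h ≗ gE ∘ hE h)
  ∘H-congʳ h (p , q) = (λ v → p (hV h v)) , (λ e → q (hE h e))

  ≈H-setoid : Graph S → Graph S → Setoid 0ℓ 0ℓ
  ≈H-setoid A B = record
    { Carrier = Hom A B ; _≈_ = _≈H_
    ; isEquivalence = record { refl = ≈H-refl ; sym = ≈H-sym ; trans = ≈H-trans } }

  module ≈H-Reasoning {A B : Graph S} = SetoidReasoning (≈H-setoid A B)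

  ∘H-injectiveʳ : ∀ {a e} {B C : Graph S} (m : Hom B C) {fV : Fin a → Fin (V B)} {fE : Fin e → Fin (E B)}
                  {hV′ : Fin a → Fin (V C)} {hE′ : Fin e → Fin (E C)} →
                  (hV m ∘ fV ≗ hV′) × (hE m ∘ fE ≗ hE′) → Injective _≡_ _≡_ hV′ × Injective _≡_ _≡_ hE′ →
                  Injective _≡_ _≡_ fV × Injective _≡_ _≡_ fE
  ∘H-injectiveʳ m (p , q) (hV-inj , hE-inj) =
    (λ {x} {y} e → hV-inj (trans (sym (p x)) (trans (cong (hV m) e) (p y)))) ,
    (λ {x} {y} e → hE-inj (trans (sym (q x)) (trans (cong (hE m) e) (q y))))

  ∘H-cancelˡ : ∀ {a e} {B C : Graph S} (m : Hom B C) → InjectiveH m →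
               {fV gV : Fin a → Fin (V B)} {fE gE : Fin e → Fin (E B)} →
               (hV m ∘ fV ≗ hV m ∘ gV) × (hE m ∘ fE ≗ hE m ∘ gE) → (fV ≗ gV) × (fE ≗ gE)
  ∘H-cancelˡ m (mV-inj , mE-inj) (p , q) = mV-inj ∘ p , mE-inj ∘ q

  infix 4 _⊑_
  _⊑_ : {X Y G : Graph S} → Hom X G → Hom Y G → Set
  h ⊑ m = (∀ v → InImgV m (hV h v)) × (∀ e → InImgE m (hE h e))

  factorThrough : {X Y G : Graph S} (h : Hom X G) (m : Hom Y G) → InjectiveH m → h ⊑ m → Hom X Y
  factorThrough {X} {Y} {G} h m (mV-inj , _) (inV , inE) = record
    { hV = λ v → proj₁ (inV v)
    ; hE = λ e → proj₁ (inE e)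
    ; src-pres  = endpoint-pres src src-pres
    ; tgt-pres  = endpoint-pres tgt tgt-pres
    ; lblV-pres = λ v → trans (sym (lblV-pres m _)) (trans (cong (lblV G) (proj₂ (inV v))) (lblV-pres h v))
    ; lblE-pres = λ e → trans (sym (lblE-pres m _)) (trans (cong (lblE G) (proj₂ (inE e))) (lblE-pres h e)) }
    where
    open ≡-Reasoning
    endpoint-pres : (s : (Z : Graph S) → Fin (E Z) → Fin (V Z)) →
                    (∀ {Z W : Graph S} (u : Hom Z W) e → hV u (s Z e) ≡ s W (hE u e)) →
                    ∀ e → proj₁ (inV (s X e)) ≡ s Y (proj₁ (inE e))
    endpoint-pres s s-pres e = mV-inj (begin
      hV m (proj₁ (inV (s X e)))  ≡⟨ proj₂ (inV (s X e)) ⟩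
      hV h (s X e)                ≡⟨ s-pres h e ⟩
      s G (hE h e)                ≡⟨ cong (s G) (proj₂ (inE e)) ⟨
      s G (hE m (proj₁ (inE e)))  ≡⟨ s-pres m (proj₁ (inE e)) ⟨
      hV m (s Y (proj₁ (inE e)))  ∎)

  factorThrough-commutes : {X Y G : Graph S} (h : Hom X G) (m : Hom Y G) (m-inj : InjectiveH m) (h⊑m : h ⊑ m) →
                           m ∘H factorThrough h m m-inj h⊑m ≈H h
  factorThrough-commutes h m m-inj (inV , inE) = (λ v → proj₂ (inV v)) , (λ e → proj₂ (inE e))

  module SameImage {D₁ D₂ G : Graph S} (d₁ : Hom D₁ G) (d₂ : Hom D₂ G) (d₁-inj : InjectiveH d₁)
                   (d₂-inj : InjectiveH d₂) (d₁⊑d₂ : d₁ ⊑ d₂) (d₂⊑d₁ : d₂ ⊑ d₁) where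
    open ≈H-Reasoning

    φ : Hom D₁ D₂
    φ = factorThrough d₁ d₂ d₂-inj d₁⊑d₂

    ψ : Hom D₂ D₁
    ψ = factorThrough d₂ d₁ d₁-inj d₂⊑d₁

    d₂φ≈d₁ : d₂ ∘H φ ≈H d₁
    d₂φ≈d₁ = factorThrough-commutes d₁ d₂ d₂-inj d₁⊑d₂

    d₁ψ≈d₂ : d₁ ∘H ψ ≈H d₂
    d₁ψ≈d₂ = factorThrough-commutes d₂ d₁ d₁-inj d₂⊑d₁

    ψφ≈id : ψ ∘H φ ≈H idH
    ψφ≈id = ∘H-cancelˡ d₁ d₁-inj (begin d₁ ∘H ψ ∘H φ  ≈⟨ ∘H-congʳ φ d₁ψ≈d₂ ⟩  d₂ ∘H φ  ≈⟨ d₂φ≈d₁ ⟩  d₁ ∎)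

    φψ≈id : φ ∘H ψ ≈H idH
    φψ≈id = ∘H-cancelˡ d₂ d₂-inj (begin d₂ ∘H φ ∘H ψ  ≈⟨ ∘H-congʳ ψ d₂φ≈d₁ ⟩  d₁ ∘H ψ  ≈⟨ d₁ψ≈d₂ ⟩  d₂ ∘H idH ∎)

  record InducedSubgraph (G : Graph S) (PV : Fin (V G) → Set) (PE : Fin (E G) → Set) : Set where
    field
      Sub         : Graph S
      ι           : Hom Sub G
      ι-injective : InjectiveH ι
      ι-∈V        : ∀ x → PV (hV ι x)
      ι-∈E        : ∀ x → PE (hE ι x)
      ∈V⇒image    : ∀ v → PV v → InImgV ι v
      ∈E⇒image    : ∀ e → PE e → InImgE ι e

  inducedSubgraph : (G : Graph S) {PV : Fin (V G) → Set} {PE : Fin (E G) → Set} →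
                    Decidable PV → Decidable PE →
                    (∀ e → PE e → PV (src G e)) → (∀ e → PE e → PV (tgt G e)) → InducedSubgraph G PV PE
  inducedSubgraph G PV? PE? src-closed tgt-closed = record
    { Sub = Sub ; ι = ι ; ι-injective = EV.elem-injective , EE.elem-injective
    ; ι-∈V = EV.elem-∈ ; ι-∈E = EE.elem-∈
    ; ∈V⇒image = λ v p → EV.index v p , EV.elem-index v p
    ; ∈E⇒image = λ e p → EE.index e p , EE.elem-index e p }
    where
    module EV = Enumeration (enumerate PV?)
    module EE = Enumeration (enumerate PE?)
    Sub : Graph S
    Sub = record
      { V = EV.size ; E = EE.size
      ; src = λ e → EV.index (src G (EE.elem e)) (src-closed _ (EE.elem-∈ e))
      ; tgt = λ e → EV.index (tgt G (EE.elem e)) (tgt-closed _ (EE.elem-∈ e))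
      ; lblV = lblV G ∘ EV.elem ; lblE = lblE G ∘ EE.elem }
    ι : Hom Sub G
    ι = record
      { hV = EV.elem ; hE = EE.elem
      ; src-pres = λ _ → EV.elem-index _ _ ; tgt-pres = λ _ → EV.elem-index _ _
      ; lblV-pres = λ _ → refl ; lblE-pres = λ _ → refl }

  -- Pushouts of graphs

  record IsComponentwisePushout {A B C P : Graph S}
                                (f : Hom A B) (g : Hom A C) (i : Hom B P) (j : Hom C P) : Set where
    constructor componentwise
    field
      onVertices : IsSetPushout (hV f) (hV g) (hV i) (hV j)
      onEdges    : IsSetPushout (hE f) (hE g) (hE i) (hE j)

  module Copairing {A B C P : Graph S} {f : Hom A B} {g : Hom A C} {i : Hom B P} {j : Hom C P}
                   (po : IsComponentwisePushout f g i j)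
                   {Q : Graph S} (b : Hom B Q) (c : Hom C Q) (bf≈cg : b ∘H f ≈H c ∘H g) where
    private
      module PV = IsSetPushout (IsComponentwisePushout.onVertices po)
      module PE = IsSetPushout (IsComponentwisePushout.onEdges po)
      module UV = PV.Copair (hV b) (hV c) (proj₁ bf≈cg)
      module UE = PE.Copair (hE b) (hE c) (proj₂ bf≈cg)

      endpoint-pres : (s : (X : Graph S) → Fin (E X) → Fin (V X)) →
                      (∀ {X Y : Graph S} (h : Hom X Y) e → hV h (s X e) ≡ s Y (hE h e)) →
                      ∀ e → UV.copair (s P e) ≡ s Q (UE.copair e)
      endpoint-pres s s-pres = PE.elim _
        (λ e → begin
          UV.copair (s P (hE j e))  ≡⟨ cong UV.copair (s-pres j e) ⟨
          UV.copair (hV j (s C e))  ≡⟨ UV.copair-j _ ⟩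
          hV c (s C e)              ≡⟨ s-pres c e ⟩
          s Q (hE c e)              ≡⟨ cong (s Q) (UE.copair-j e) ⟨
          s Q (UE.copair (hE j e))  ∎)
        (λ e → begin
          UV.copair (s P (hE i e))  ≡⟨ cong UV.copair (s-pres i e) ⟨
          UV.copair (hV i (s B e))  ≡⟨ UV.copair-i _ ⟩
          hV b (s B e)              ≡⟨ s-pres b e ⟩
          s Q (hE b e)              ≡⟨ cong (s Q) (UE.copair-i e) ⟨
          s Q (UE.copair (hE i e))  ∎)
        where open ≡-Reasoning

    copair : Hom P Q
    copair = record
      { hV = UV.copair ; hE = UE.copair
      ; src-pres  = endpoint-pres src src-pres
      ; tgt-pres  = endpoint-pres tgt tgt-pres
      ; lblV-pres = PV.elim _
          (λ x → trans (cong (lblV Q) (UV.copair-j x)) (trans (lblV-pres c x) (sym (lblV-pres j x))))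
          (λ x → trans (cong (lblV Q) (UV.copair-i x)) (trans (lblV-pres b x) (sym (lblV-pres i x))))
      ; lblE-pres = PE.elim _
          (λ x → trans (cong (lblE Q) (UE.copair-j x)) (trans (lblE-pres c x) (sym (lblE-pres j x))))
          (λ x → trans (cong (lblE Q) (UE.copair-i x)) (trans (lblE-pres b x) (sym (lblE-pres i x)))) }

    copair-i : copair ∘H i ≈H b
    copair-i = UV.copair-i , UE.copair-i

    copair-j : copair ∘H j ≈H c
    copair-j = UV.copair-j , UE.copair-j

    copair-unique : (u : Hom P Q) → u ∘H i ≈H b → u ∘H j ≈H c → u ≈H copair
    copair-unique u (ui≗b , ui≗bE) (uj≗c , uj≗cE) =
      PV.elim _ (λ x → trans (uj≗c x) (sym (UV.copair-j x))) (λ x → trans (ui≗b x) (sym (UV.copair-i x))) ,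
      PE.elim _ (λ x → trans (uj≗cE x) (sym (UE.copair-j x))) (λ x → trans (ui≗bE x) (sym (UE.copair-i x)))

  componentwise⇒isPushout : {A B C P : Graph S} {f : Hom A B} {g : Hom A C} {i : Hom B P} {j : Hom C P} →
                            IsComponentwisePushout f g i j → IsPushout f g i j
  componentwise⇒isPushout po = record
    { commutes  = IsSetPushout.commutes onVertices , IsSetPushout.commutes onEdges
    ; universal = λ Q b c bf≈cg → let open Copairing po b c bf≈cg in
                    copair , copair-i , copair-j , λ u ui≈b uj≈c → copair-unique u ui≈b uj≈c }
    where open IsComponentwisePushout po

  record Pushout {A B C : Graph S} (f : Hom A B) (g : Hom A C) : Set where
    field
      P               : Graph S
      i               : Hom B P
      j               : Hom C P
      isComponentwise : IsComponentwisePushout f g i j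

    isPushout : IsPushout f g i j
    isPushout = componentwise⇒isPushout isComponentwise

    j-injective : InjectiveH j
    j-injective = IsSetPushout.j-injective (IsComponentwisePushout.onVertices isComponentwise) ,
                  IsSetPushout.j-injective (IsComponentwisePushout.onEdges isComponentwise)

  pushout : {A B C : Graph S} (f : Hom A B) → InjectiveH f → (g : Hom A C) → Pushout f g
  pushout {A} {B} {C} f (fV-inj , fE-inj) g = record
    { P = P ; i = i ; j = j ; isComponentwise = componentwise SV.isSetPushout SE.isSetPushout }
    where
    module SV = SetPushout (hV f) fV-inj (hV g)
    module SE = SetPushout (hE f) fE-inj (hE g)
    endpoint : ((X : Graph S) → Fin (E X) → Fin (V X)) → Fin SE.P → Fin SV.P
    endpoint s = [ SV.j ∘ s C , SV.i ∘ s B ∘ SE.elem ]′ ∘ splitAt (E C)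
    P : Graph S
    P = record
      { V = SV.P ; E = SE.P ; src = endpoint src ; tgt = endpoint tgt
      ; lblV = [ lblV C , lblV B ∘ SV.elem ]′ ∘ splitAt (V C)
      ; lblE = [ lblE C , lblE B ∘ SE.elem ]′ ∘ splitAt (E C) }
    endpoint-j : ∀ s c → SV.j (s C c) ≡ endpoint s (SE.j c)
    endpoint-j s c = sym (cong [ SV.j ∘ s C , SV.i ∘ s B ∘ SE.elem ]′ (splitAt-↑ˡ (E C) c SE.size))
    j : Hom C P
    j = record
      { hV = SV.j ; hE = SE.j
      ; src-pres  = endpoint-j src ; tgt-pres = endpoint-j tgt
      ; lblV-pres = λ c → cong [ lblV C , lblV B ∘ SV.elem ]′ (splitAt-↑ˡ (V C) c SV.size)
      ; lblE-pres = λ c → cong [ lblE C , lblE B ∘ SE.elem ]′ (splitAt-↑ˡ (E C) c SE.size) }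
    endpoint-i : (s : (X : Graph S) → Fin (E X) → Fin (V X)) →
                 (∀ {X Y : Graph S} (h : Hom X Y) e → hV h (s X e) ≡ s Y (hE h e)) →
                 ∀ e → SV.i (s B e) ≡ endpoint s (SE.i e)
    endpoint-i s s-pres = SE.i-elim (λ x e → SV.i (s B e) ≡ endpoint s x)
      (λ a → begin
        SV.i (s B (hE f a))   ≡⟨ cong SV.i (s-pres f a) ⟨
        SV.i (hV f (s A a))   ≡⟨ SV.i-image (s A a) ⟩
        SV.j (hV g (s A a))   ≡⟨ cong SV.j (s-pres g a) ⟩
        SV.j (s C (hE g a))   ≡⟨ endpoint-j s (hE g a) ⟩
        endpoint s (SE.j (hE g a)) ∎)
      (λ b b∉f → begin
        SV.i (s B b)                          ≡⟨ cong (SV.i ∘ s B) (SE.elem-index b b∉f) ⟨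
        SV.i (s B (SE.elem (SE.index b b∉f))) ≡⟨ cong [ SV.j ∘ s C , SV.i ∘ s B ∘ SE.elem ]′
                                                        (splitAt-↑ʳ (E C) SE.size _) ⟨
        endpoint s (E C ↑ʳ SE.index b b∉f)    ∎)
      where open ≡-Reasoning
    i : Hom B P
    i = record
      { hV = SV.i ; hE = SE.i
      ; src-pres  = endpoint-i src src-pres
      ; tgt-pres  = endpoint-i tgt tgt-pres
      ; lblV-pres = SV.i-elim (λ x b → lblV P x ≡ lblV B b)
          (λ a → trans (lblV-pres j (hV g a)) (trans (lblV-pres g a) (sym (lblV-pres f a))))
          (λ b b∉f → trans (cong [ lblV C , lblV B ∘ SV.elem ]′ (splitAt-↑ʳ (V C) SV.size _))
                           (cong (lblV B) (SV.elem-index b b∉f)))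
      ; lblE-pres = SE.i-elim (λ x b → lblE P x ≡ lblE B b)
          (λ a → trans (lblE-pres j (hE g a)) (trans (lblE-pres g a) (sym (lblE-pres f a))))
          (λ b b∉f → trans (cong [ lblE C , lblE B ∘ SE.elem ]′ (splitAt-↑ʳ (E C) SE.size _))
                           (cong (lblE B) (SE.elem-index b b∉f))) }

  module Mediator {A B C P : Graph S} {f : Hom A B} {g : Hom A C} {i : Hom B P} {j : Hom C P}
                  (po : IsPushout f g i j) {Q : Graph S} (b : Hom B Q) (c : Hom C Q) (bf≈cg : b ∘H f ≈H c ∘H g) where
    mediator : Hom P Q
    mediator = proj₁ (IsPushout.universal po Q b c bf≈cg)

    mediator-i : mediator ∘H i ≈H b
    mediator-i = proj₁ (proj₂ (IsPushout.universal po Q b c bf≈cg))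

    mediator-j : mediator ∘H j ≈H c
    mediator-j = proj₁ (proj₂ (proj₂ (IsPushout.universal po Q b c bf≈cg)))

  IsPushout-jointlyEpic : {A B C P Q : Graph S} {f : Hom A B} {g : Hom A C} {i : Hom B P} {j : Hom C P} →
                          IsPushout f g i j → (u₁ u₂ : Hom P Q) →
                          u₁ ∘H i ≈H u₂ ∘H i → u₁ ∘H j ≈H u₂ ∘H j → u₁ ≈H u₂
  IsPushout-jointlyEpic {Q = Q} {i = i} {j} po u₁ u₂ u₁i≈u₂i u₁j≈u₂j
    with IsPushout.universal po Q (u₂ ∘H i) (u₂ ∘H j) (∘H-congˡ u₂ (IsPushout.commutes po))
  ... | u , _ , _ , unique = ≈H-trans (unique u₁ u₁i≈u₂i u₁j≈u₂j) (≈H-sym (unique u₂ ≈H-refl ≈H-refl))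

  IsPushout-sym : {A B C P : Graph S} {f : Hom A B} {g : Hom A C} {i : Hom B P} {j : Hom C P} →
                  IsPushout f g i j → IsPushout g f j i
  IsPushout-sym po = record
    { commutes  = ≈H-sym (IsPushout.commutes po)
    ; universal = λ Q c b cg≈bf → let (u , ui≈b , uj≈c , unique) = IsPushout.universal po Q b c (≈H-sym cg≈bf)
                                  in u , uj≈c , ui≈b , λ u' u'j≈c u'i≈b → unique u' u'i≈b u'j≈c }

  --   A --a--> B
  --   |b       |c
  --   C --d--> P
  --   |e       |x
  --   Q --y--> M
  IsPushout-paste : {A B C P Q M : Graph S} {a : Hom A B} {b : Hom A C} {c : Hom B P} {d : Hom C P}
                    {e : Hom C Q} {x : Hom P M} {y : Hom Q M} →
                    IsPushout a b c d → IsPushout d e x y → IsPushout a (e ∘H b) (x ∘H c) y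
  IsPushout-paste {B = B} {Q = Q} {M} {a} {b} {c} {d} {e} {x} {y} po₁ po₂ = record
    { commutes  = begin
        x ∘H c ∘H a  ≈⟨ ∘H-congˡ x (IsPushout.commutes po₁) ⟩
        x ∘H d ∘H b  ≈⟨ ∘H-congʳ b (IsPushout.commutes po₂) ⟩
        y ∘H e ∘H b  ∎
    ; universal = universal }
    where
    open ≈H-Reasoning
    universal : ∀ (Z : Graph S) (β : Hom B Z) (γ : Hom Q Z) → β ∘H a ≈H γ ∘H (e ∘H b) →
                Σ (Hom M Z) λ u → (u ∘H (x ∘H c) ≈H β) × (u ∘H y ≈H γ) ×
                  (∀ (u' : Hom M Z) → u' ∘H (x ∘H c) ≈H β → u' ∘H y ≈H γ → u' ≈H u)
    universal Z β γ βa≈γeb with IsPushout.universal po₁ Z β (γ ∘H e) βa≈γeb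
    ... | u₁ , u₁c≈β , u₁d≈γe , unique₁ with IsPushout.universal po₂ Z u₁ γ u₁d≈γe
    ... | u₂ , u₂x≈u₁ , u₂y≈γ , unique₂ =
      u₂ , ≈H-trans (∘H-congʳ c u₂x≈u₁) u₁c≈β , u₂y≈γ ,
      λ u' u'xc≈β u'y≈γ → unique₂ u' (unique₁ (u' ∘H x) u'xc≈β (begin
        u' ∘H x ∘H d  ≈⟨ ∘H-congˡ u' (IsPushout.commutes po₂) ⟩
        u' ∘H y ∘H e  ≈⟨ ∘H-congʳ e u'y≈γ ⟩
        γ ∘H e        ∎)) u'y≈γ

  -- In the diagram above: the lower square is a pushout when the upper one and the outer
  -- rectangle are, with b' and c' standing for e ∘ b and x ∘ c up to ≈H.
  IsPushout-cancel : {A B C P Q M : Graph S} {a : Hom A B} {b : Hom A C} {c : Hom B P} {d : Hom C P}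
                     {e : Hom C Q} {x : Hom P M} {y : Hom Q M} {b' : Hom A Q} {c' : Hom B M} →
                     IsPushout a b c d → IsPushout a b' c' y →
                     e ∘H b ≈H b' → x ∘H c ≈H c' → x ∘H d ≈H y ∘H e → IsPushout d e x y
  IsPushout-cancel {P = P} {Q} {M} {a} {b} {c} {d} {e} {x} {y} {b'} {c'} po₁ outer eb≈b' xc≈c' xd≈ye = record
    { commutes = xd≈ye ; universal = universal }
    where
    open ≈H-Reasoning
    universal : ∀ (Z : Graph S) (β : Hom P Z) (γ : Hom Q Z) → β ∘H d ≈H γ ∘H e →
                Σ (Hom M Z) λ u → (u ∘H x ≈H β) × (u ∘H y ≈H γ) ×
                  (∀ (u' : Hom M Z) → u' ∘H x ≈H β → u' ∘H y ≈H γ → u' ≈H u)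
    universal Z β γ βd≈γe with IsPushout.universal outer Z (β ∘H c) γ (begin
        β ∘H c ∘H a   ≈⟨ ∘H-congˡ β (IsPushout.commutes po₁) ⟩
        β ∘H d ∘H b   ≈⟨ ∘H-congʳ b βd≈γe ⟩
        γ ∘H e ∘H b   ≈⟨ ∘H-congˡ γ eb≈b' ⟩
        γ ∘H b'       ∎)
    ... | u , uc'≈βc , uy≈γ , unique = u , ux≈β , uy≈γ , unique′
      where
      ux≈β : u ∘H x ≈H β
      ux≈β = IsPushout-jointlyEpic po₁ (u ∘H x) β
        (begin u ∘H x ∘H c  ≈⟨ ∘H-congˡ u xc≈c' ⟩  u ∘H c'  ≈⟨ uc'≈βc ⟩  β ∘H c ∎)
        (begin u ∘H x ∘H d  ≈⟨ ∘H-congˡ u xd≈ye ⟩  u ∘H y ∘H e  ≈⟨ ∘H-congʳ e uy≈γ ⟩  γ ∘H e  ≈⟨ βd≈γe ⟨  β ∘H d ∎)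
      unique′ : ∀ u' → u' ∘H x ≈H β → u' ∘H y ≈H γ → u' ≈H u
      unique′ u' u'x≈β u'y≈γ = unique u'
        (begin u' ∘H c'  ≈⟨ ∘H-congˡ u' xc≈c' ⟨  u' ∘H x ∘H c  ≈⟨ ∘H-congʳ c u'x≈β ⟩  β ∘H c ∎)
        u'y≈γ

  IsPushout-iso : {A B C₁ C₂ P₁ P₂ : Graph S} {f : Hom A B}
                  {g₁ : Hom A C₁} {i₁ : Hom B P₁} {j₁ : Hom C₁ P₁}
                  {g₂ : Hom A C₂} {i₂ : Hom B P₂} {j₂ : Hom C₂ P₂} →
                  IsPushout f g₁ i₁ j₁ → IsPushout f g₂ i₂ j₂ →
                  (φ : Hom C₁ C₂) (ψ : Hom C₂ C₁) → ψ ∘H φ ≈H idH → φ ∘H ψ ≈H idH → φ ∘H g₁ ≈H g₂ →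
                  Σ (P₁ ≅ P₂) λ { (u , _) → (u ∘H i₁ ≈H i₂) × (u ∘H j₁ ≈H j₂ ∘H φ) }
  IsPushout-iso {f = f} {g₁} {i₁} {j₁} {g₂} {i₂} {j₂} po₁ po₂ φ ψ ψφ≈id φψ≈id φg₁≈g₂ =
    (u , v , vu≈id , uv≈id) , ui₁≈i₂ , uj₁≈j₂φ
    where
    open ≈H-Reasoning
    open Mediator po₁ i₂ (j₂ ∘H φ) (begin
        i₂ ∘H f        ≈⟨ IsPushout.commutes po₂ ⟩
        j₂ ∘H g₂       ≈⟨ ∘H-congˡ j₂ φg₁≈g₂ ⟨
        j₂ ∘H φ ∘H g₁  ∎)
      renaming (mediator to u; mediator-i to ui₁≈i₂; mediator-j to uj₁≈j₂φ)
    open Mediator po₂ i₁ (j₁ ∘H ψ) (begin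
        i₁ ∘H f             ≈⟨ IsPushout.commutes po₁ ⟩
        j₁ ∘H g₁            ≈⟨ ∘H-congˡ j₁ (∘H-congʳ g₁ ψφ≈id) ⟨
        j₁ ∘H ψ ∘H φ ∘H g₁  ≈⟨ ∘H-congˡ (j₁ ∘H ψ) φg₁≈g₂ ⟩
        j₁ ∘H ψ ∘H g₂       ∎)
      renaming (mediator to v; mediator-i to vi₂≈i₁; mediator-j to vj₂≈j₁ψ)
    vu≈id : v ∘H u ≈H idH
    vu≈id = IsPushout-jointlyEpic po₁ (v ∘H u) idH
      (begin v ∘H u ∘H i₁  ≈⟨ ∘H-congˡ v ui₁≈i₂ ⟩  v ∘H i₂  ≈⟨ vi₂≈i₁ ⟩  i₁ ∎)
      (begin
        v ∘H u ∘H j₁   ≈⟨ ∘H-congˡ v uj₁≈j₂φ ⟩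
        v ∘H j₂ ∘H φ   ≈⟨ ∘H-congʳ φ vj₂≈j₁ψ ⟩
        j₁ ∘H ψ ∘H φ   ≈⟨ ∘H-congˡ j₁ ψφ≈id ⟩
        j₁             ∎)
    uv≈id : u ∘H v ≈H idH
    uv≈id = IsPushout-jointlyEpic po₂ (u ∘H v) idH
      (begin u ∘H v ∘H i₂  ≈⟨ ∘H-congˡ u vi₂≈i₁ ⟩  u ∘H i₁  ≈⟨ ui₁≈i₂ ⟩  i₂ ∎)
      (begin
        u ∘H v ∘H j₂   ≈⟨ ∘H-congˡ u vj₂≈j₁ψ ⟩
        u ∘H j₁ ∘H ψ   ≈⟨ ∘H-congʳ ψ uj₁≈j₂φ ⟩
        j₂ ∘H φ ∘H ψ   ≈⟨ ∘H-congˡ j₂ φψ≈id ⟩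
        j₂             ∎)

  isPushout⇒componentwise : {A B C P : Graph S} {f : Hom A B} {g : Hom A C} {i : Hom B P} {j : Hom C P} →
                            InjectiveH f → IsPushout f g i j → IsComponentwisePushout f g i j
  isPushout⇒componentwise {f = f} {g} f-inj po =
    let ((u , v , vu≈id , uv≈id) , ui₀≈i , uj₀≈j) = IsPushout-iso P₀.isPushout po idH idH ≈H-refl ≈H-refl ≈H-refl
    in componentwise
         (IsSetPushout-transport P₀.onVertices (hV u) (hV v) (proj₁ uv≈id) (proj₁ vu≈id) (proj₁ ui₀≈i) (proj₁ uj₀≈j))
         (IsSetPushout-transport P₀.onEdges    (hE u) (hE v) (proj₂ uv≈id) (proj₂ vu≈id) (proj₂ ui₀≈i) (proj₂ uj₀≈j))
    where
    module P₀ where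
      open Pushout (pushout f f-inj g) public
      open IsComponentwisePushout isComponentwise public

  IsPushout-j-injective : {A B C P : Graph S} {f : Hom A B} {g : Hom A C} {i : Hom B P} {j : Hom C P} →
                          InjectiveH f → IsPushout f g i j → InjectiveH j
  IsPushout-j-injective f-inj po =
    let componentwise poV poE = isPushout⇒componentwise f-inj po
    in IsSetPushout.j-injective poV , IsSetPushout.j-injective poE

  -- For injective d₁ and d₂ this is their pullback: N is the part of G lying in both images.
  record Intersection {D₁ D₂ G : Graph S} (d₁ : Hom D₁ G) (d₂ : Hom D₂ G) : Set where
    field
      N            : Graph S
      n₁           : Hom N D₁
      n₂           : Hom N D₂
      commutes     : d₁ ∘H n₁ ≈H d₂ ∘H n₂
      n₁-injective : InjectiveH n₁
      n₂-injective : InjectiveH n₂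
      n₁-onto      : (∀ x → InImgV d₂ (hV d₁ x) → InImgV n₁ x) × (∀ x → InImgE d₂ (hE d₁ x) → InImgE n₁ x)
      n₂-onto      : (∀ x → InImgV d₁ (hV d₂ x) → InImgV n₂ x) × (∀ x → InImgE d₁ (hE d₂ x) → InImgE n₂ x)

  Intersection-sym : {D₁ D₂ G : Graph S} {d₁ : Hom D₁ G} {d₂ : Hom D₂ G} → Intersection d₁ d₂ → Intersection d₂ d₁
  Intersection-sym I = record
    { N = N ; n₁ = n₂ ; n₂ = n₁ ; commutes = ≈H-sym commutes
    ; n₁-injective = n₂-injective ; n₂-injective = n₁-injective ; n₁-onto = n₂-onto ; n₂-onto = n₁-onto }
    where open Intersection I

  intersection : {D₁ D₂ G : Graph S} (d₁ : Hom D₁ G) (d₂ : Hom D₂ G) → InjectiveH d₁ → InjectiveH d₂ →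
                 Intersection d₁ d₂
  intersection {D₁} {D₂} {G} d₁ d₂ d₁-inj d₂-inj = record
    { N = Sub ; n₁ = ι ; n₂ = n₂ ; commutes = ≈H-sym d₂n₂≈d₁ι
    ; n₁-injective = ι-injective
    ; n₂-injective = ∘H-injectiveʳ d₂ d₂n₂≈d₁ι (∘H-injective d₁-inj ι-injective)
    ; n₁-onto = ∈V⇒image , ∈E⇒image
    ; n₂-onto = (λ y (x , d₁x≡d₂y) → let (z , ιz≡x) = ∈V⇒image x (y , sym d₁x≡d₂y) in
                   z , proj₁ d₂-inj (trans (proj₁ d₂n₂≈d₁ι z) (trans (cong (hV d₁) ιz≡x) d₁x≡d₂y))) ,
                (λ y (x , d₁x≡d₂y) → let (z , ιz≡x) = ∈E⇒image x (y , sym d₁x≡d₂y) in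
                   z , proj₂ d₂-inj (trans (proj₂ d₂n₂≈d₁ι z) (trans (cong (hE d₁) ιz≡x) d₁x≡d₂y))) }
    where
    open InducedSubgraph (inducedSubgraph D₁ (λ x → img? (hV d₂) (hV d₁ x)) (λ x → img? (hE d₂) (hE d₁ x))
      (λ e (y , d₂y≡d₁e) → src D₂ y , trans (src-pres d₂ y) (trans (cong (src G) d₂y≡d₁e) (sym (src-pres d₁ e))))
      (λ e (y , d₂y≡d₁e) → tgt D₂ y , trans (tgt-pres d₂ y) (trans (cong (tgt G) d₂y≡d₁e) (sym (tgt-pres d₁ e)))))
    n₂ : Hom Sub D₂
    n₂ = factorThrough (d₁ ∘H ι) d₂ d₂-inj (ι-∈V , ι-∈E)
    d₂n₂≈d₁ι : d₂ ∘H n₂ ≈H d₁ ∘H ι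
    d₂n₂≈d₁ι = factorThrough-commutes (d₁ ∘H ι) d₂ d₂-inj (ι-∈V , ι-∈E)

  Intersection-⊑n₂ : {K D G G' : Graph S} {m : Hom G' G} {d : Hom D G} (I : Intersection m d)
                     (k : Hom K D) (h : Hom K G') → m ∘H h ≈H d ∘H k → k ⊑ Intersection.n₂ I
  Intersection-⊑n₂ I k h (mh≗dkV , mh≗dkE) =
    (λ x → proj₁ n₂-onto (hV k x) (hV h x , mh≗dkV x)) , (λ x → proj₂ n₂-onto (hE k x) (hE h x , mh≗dkE x))
    where open Intersection I

  IsPushout-restrict : {K L D G G' : Graph S} {l : Hom K L} {k : Hom K D} {g : Hom L G} {d : Hom D G}
                       {m : Hom G' G} (I : Intersection m d) {g' : Hom L G'} {k' : Hom K (Intersection.N I)} →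
                       InjectiveH l → InjectiveH g → InjectiveH m → IsPushout l k g d →
                       m ∘H g' ≈H g → Intersection.n₂ I ∘H k' ≈H k → IsPushout l k' g' (Intersection.n₁ I)
  IsPushout-restrict I l-inj (gV-inj , gE-inj) (mV-inj , mE-inj) po (mg'≈gV , mg'≈gE) (nk'≈kV , nk'≈kE) =
    componentwise⇒isPushout (componentwise
      (IsSetPushout-restrict poV gV-inj mV-inj (proj₁ n₂-injective) mg'≈gV nk'≈kV (proj₁ commutes) (proj₁ n₂-onto))
      (IsSetPushout-restrict poE gE-inj mE-inj (proj₂ n₂-injective) mg'≈gE nk'≈kE (proj₂ commutes) (proj₂ n₂-onto)))
    where
    open Intersection I
    open IsComponentwisePushout (isPushout⇒componentwise l-inj po) renaming (onVertices to poV; onEdges to poE)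

-- Direct derivations

module _ {S : Signature} where
  open Rule
  private module DD = DirectDerivation

  DirectDerivation-d-injective : {ρ : Rule {S}} {G H : Graph S} {g : Hom (L ρ) G} (δ : DirectDerivation ρ g H) →
                                 InjectiveH (DD.d δ)
  DirectDerivation-d-injective {ρ} δ = IsPushout-j-injective (l-inj ρ) (DD.po₁ δ)

  DirectDerivation-e-injective : {ρ : Rule {S}} {G H : Graph S} {g : Hom (L ρ) G} (δ : DirectDerivation ρ g H) →
                                 InjectiveH (DD.e δ)
  DirectDerivation-e-injective {ρ} δ = IsPushout-j-injective (r-inj ρ) (DD.po₂ δ)

  restrictDerivation : {ρ : Rule {S}} {G G' H : Graph S} {g : Hom (L ρ) G} → DirectDerivation ρ g H →
                       (m : Hom G' G) → InjectiveH m → (g' : Hom (L ρ) G') → m ∘H g' ≈H g →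
                       Σ (Graph S) λ H' → DirectDerivation ρ g' H'
  restrictDerivation {ρ} δ m m-inj g' mg'≈g = Pushout.P H' , record
    { match-inj = ∘H-injectiveʳ m mg'≈g (DD.match-inj δ)
    ; D = N ; k = k' ; d = n₁ ; h = Pushout.i H' ; e = Pushout.j H'
    ; po₁ = IsPushout-restrict I (l-inj ρ) (DD.match-inj δ) m-inj (DD.po₁ δ) mg'≈g n₂k'≈k
    ; po₂ = Pushout.isPushout H' }
    where
    I : Intersection m (DD.d δ)
    I = intersection m (DD.d δ) m-inj (DirectDerivation-d-injective δ)
    open Intersection I
    k⊑n₂ : DD.k δ ⊑ n₂
    k⊑n₂ = Intersection-⊑n₂ I (DD.k δ) (g' ∘H l ρ) mg'l≈dk
      where
      mg'l≈dk : m ∘H g' ∘H l ρ ≈H DD.d δ ∘H DD.k δ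
      mg'l≈dk = ≈H-trans (∘H-congʳ (l ρ) mg'≈g) (IsPushout.commutes (DD.po₁ δ))
    k' : Hom (K ρ) N
    k' = factorThrough (DD.k δ) n₂ n₂-injective k⊑n₂
    n₂k'≈k : n₂ ∘H k' ≈H DD.k δ
    n₂k'≈k = factorThrough-commutes (DD.k δ) n₂ n₂-injective k⊑n₂
    H' : Pushout (r ρ) k'
    H' = pushout (r ρ) (r-inj ρ) k'

  sameMatch⇒context-⊑ : {ρ : Rule {S}} {G H H' : Graph S} {g g' : Hom (L ρ) G} → g ≈H g' →
                        (δ : DirectDerivation ρ g H) (δ' : DirectDerivation ρ g' H') → DD.d δ ⊑ DD.d δ'
  sameMatch⇒context-⊑ {ρ} {g = g} {g'} (g≗g'V , g≗g'E) δ δ' =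
    pushoutComplement-image-⊆ (onVertices po) (onVertices po') g≗g'V ,
    pushoutComplement-image-⊆ (onEdges po) (onEdges po') g≗g'E
    where
    open IsComponentwisePushout
    po : IsComponentwisePushout (l ρ) (DD.k δ) g (DD.d δ)
    po = isPushout⇒componentwise (l-inj ρ) (DD.po₁ δ)
    po' : IsComponentwisePushout (l ρ) (DD.k δ') g' (DD.d δ')
    po' = isPushout⇒componentwise (l-inj ρ) (DD.po₁ δ')

  derivation-unique : {ρ : Rule {S}} {G H₁ H₂ : Graph S} {g₁ g₂ : Hom (L ρ) G} → g₁ ≈H g₂ →
                      DirectDerivation ρ g₁ H₁ → DirectDerivation ρ g₂ H₂ → H₁ ≅ H₂
  derivation-unique {ρ} {g₁ = g₁} {g₂} g₁≈g₂ δ₁ δ₂ =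
    proj₁ (IsPushout-iso (DD.po₂ δ₁) (DD.po₂ δ₂) φ ψ ψφ≈id φψ≈id φk₁≈k₂)
    where
    open ≈H-Reasoning
    open SameImage (DD.d δ₁) (DD.d δ₂) (DirectDerivation-d-injective δ₁) (DirectDerivation-d-injective δ₂)
                   (sameMatch⇒context-⊑ g₁≈g₂ δ₁ δ₂) (sameMatch⇒context-⊑ (≈H-sym g₁≈g₂) δ₂ δ₁)
    φk₁≈k₂ : φ ∘H DD.k δ₁ ≈H DD.k δ₂
    φk₁≈k₂ = ∘H-cancelˡ (DD.d δ₂) (DirectDerivation-d-injective δ₂) (begin
      DD.d δ₂ ∘H φ ∘H DD.k δ₁  ≈⟨ ∘H-congʳ (DD.k δ₁) d₂φ≈d₁ ⟩
      DD.d δ₁ ∘H DD.k δ₁       ≈⟨ IsPushout.commutes (DD.po₁ δ₁) ⟨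
      g₁ ∘H l ρ                ≈⟨ ∘H-congʳ (l ρ) g₁≈g₂ ⟩
      g₂ ∘H l ρ                ≈⟨ IsPushout.commutes (DD.po₁ δ₂) ⟩
      DD.d δ₂ ∘H DD.k δ₂       ∎)

  -- Parallel independence in the form the Local Church–Rosser construction consumes: each match
  -- survives in the other derivation's context, and both interfaces lie in the common context N.
  record Independence {ρ₁ ρ₂ : Rule {S}} {G H₁ H₂ : Graph S} {g₁ : Hom (L ρ₁) G} {g₂ : Hom (L ρ₂) G}
                      (δ₁ : DirectDerivation ρ₁ g₁ H₁) (δ₂ : DirectDerivation ρ₂ g₂ H₂) : Set where
    field
      common   : Intersection (DD.d δ₁) (DD.d δ₂)
    open Intersection common public
    field
      g₁′      : Hom (L ρ₁) (DD.D δ₂)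
      d₂g₁′≈g₁ : DD.d δ₂ ∘H g₁′ ≈H g₁
      g₂′      : Hom (L ρ₂) (DD.D δ₁)
      d₁g₂′≈g₂ : DD.d δ₁ ∘H g₂′ ≈H g₂
      k₁′      : Hom (K ρ₁) N
      n₁k₁′≈k₁ : n₁ ∘H k₁′ ≈H DD.k δ₁
      k₂′      : Hom (K ρ₂) N
      n₂k₂′≈k₂ : n₂ ∘H k₂′ ≈H DD.k δ₂

  Independence-sym : {ρ₁ ρ₂ : Rule {S}} {G H₁ H₂ : Graph S} {g₁ : Hom (L ρ₁) G} {g₂ : Hom (L ρ₂) G}
                     {δ₁ : DirectDerivation ρ₁ g₁ H₁} {δ₂ : DirectDerivation ρ₂ g₂ H₂} →
                     Independence δ₁ δ₂ → Independence δ₂ δ₁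
  Independence-sym ind = record
    { common = Intersection-sym common
    ; g₁′ = g₂′ ; d₂g₁′≈g₁ = d₁g₂′≈g₂ ; g₂′ = g₁′ ; d₁g₂′≈g₂ = d₂g₁′≈g₁
    ; k₁′ = k₂′ ; n₁k₁′≈k₁ = n₂k₂′≈k₂ ; k₂′ = k₁′ ; n₂k₂′≈k₂ = n₁k₁′≈k₁ }
    where open Independence ind

  parallelIndependent⇒Independence :
    {ρ₁ ρ₂ : Rule {S}} {G H₁ H₂ : Graph S} {g₁ : Hom (L ρ₁) G} {g₂ : Hom (L ρ₂) G} →
    ParallelIndependent ρ₁ ρ₂ g₁ g₂ →
    (δ₁ : DirectDerivation ρ₁ g₁ H₁) (δ₂ : DirectDerivation ρ₂ g₂ H₂) → Independence δ₁ δ₂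
  parallelIndependent⇒Independence {ρ₁} {ρ₂} {G} {g₁ = g₁} {g₂} (indV , indE) δ₁ δ₂ = record
    { common = I
    ; g₁′ = g₁′ ; d₂g₁′≈g₁ = d₂g₁′≈g₁ ; g₂′ = g₂′ ; d₁g₂′≈g₂ = d₁g₂′≈g₂
    ; k₁′ = factorThrough (DD.k δ₁) n₁ n₁-injective k₁⊑n₁
    ; n₁k₁′≈k₁ = factorThrough-commutes (DD.k δ₁) n₁ n₁-injective k₁⊑n₁
    ; k₂′ = factorThrough (DD.k δ₂) n₂ n₂-injective k₂⊑n₂
    ; n₂k₂′≈k₂ = factorThrough-commutes (DD.k δ₂) n₂ n₂-injective k₂⊑n₂ }
    where
    open IsComponentwisePushout
    d₁ : Hom (DD.D δ₁) G
    d₁ = DD.d δ₁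
    d₂ : Hom (DD.D δ₂) G
    d₂ = DD.d δ₂
    I : Intersection d₁ d₂
    I = intersection d₁ d₂ (DirectDerivation-d-injective δ₁) (DirectDerivation-d-injective δ₂)
    open Intersection I
    left₁ : IsComponentwisePushout (l ρ₁) (DD.k δ₁) g₁ d₁
    left₁ = isPushout⇒componentwise (l-inj ρ₁) (DD.po₁ δ₁)
    left₂ : IsComponentwisePushout (l ρ₂) (DD.k δ₂) g₂ d₂
    left₂ = isPushout⇒componentwise (l-inj ρ₂) (DD.po₁ δ₂)
    g₂⊑d₁ : g₂ ⊑ d₁
    g₂⊑d₁ =
      (λ a → IsSetPushout-⊆context (onVertices left₁) (proj₁ (DD.match-inj δ₁)) (hV g₂ a)
               λ p → proj₁ (indV _ p (a , refl))) ,
      (λ a → IsSetPushout-⊆context (onEdges left₁) (proj₂ (DD.match-inj δ₁)) (hE g₂ a)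
               λ p → proj₁ (indE _ p (a , refl)))
    g₁⊑d₂ : g₁ ⊑ d₂
    g₁⊑d₂ =
      (λ a → IsSetPushout-⊆context (onVertices left₂) (proj₁ (DD.match-inj δ₂)) (hV g₁ a)
               λ p → proj₂ (indV _ (a , refl) p)) ,
      (λ a → IsSetPushout-⊆context (onEdges left₂) (proj₂ (DD.match-inj δ₂)) (hE g₁ a)
               λ p → proj₂ (indE _ (a , refl) p))
    g₁′ : Hom (L ρ₁) (DD.D δ₂)
    g₁′ = factorThrough g₁ d₂ (DirectDerivation-d-injective δ₂) g₁⊑d₂
    d₂g₁′≈g₁ : d₂ ∘H g₁′ ≈H g₁
    d₂g₁′≈g₁ = factorThrough-commutes g₁ d₂ (DirectDerivation-d-injective δ₂) g₁⊑d₂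
    g₂′ : Hom (L ρ₂) (DD.D δ₁)
    g₂′ = factorThrough g₂ d₁ (DirectDerivation-d-injective δ₁) g₂⊑d₁
    d₁g₂′≈g₂ : d₁ ∘H g₂′ ≈H g₂
    d₁g₂′≈g₂ = factorThrough-commutes g₂ d₁ (DirectDerivation-d-injective δ₁) g₂⊑d₁
    k₁⊑n₁ : DD.k δ₁ ⊑ n₁
    k₁⊑n₁ = Intersection-⊑n₂ (Intersection-sym I) (DD.k δ₁) (g₁′ ∘H l ρ₁)
              (≈H-trans (∘H-congʳ (l ρ₁) d₂g₁′≈g₁) (IsPushout.commutes (DD.po₁ δ₁)))
    k₂⊑n₂ : DD.k δ₂ ⊑ n₂
    k₂⊑n₂ = Intersection-⊑n₂ I (DD.k δ₂) (g₂′ ∘H l ρ₂)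
              (≈H-trans (∘H-congʳ (l ρ₂) d₁g₂′≈g₂) (IsPushout.commutes (DD.po₁ δ₂)))

  -- The second derivation, replayed after the first: its new context D₁′ is the result of applying
  -- ρ₁ to the common context N, and M glues D₁′ and D₂′ along N.
  residual : {ρ₁ ρ₂ : Rule {S}} {G H₁ H₂ : Graph S} {g₁ : Hom (L ρ₁) G} {g₂ : Hom (L ρ₂) G}
             {δ₁ : DirectDerivation ρ₁ g₁ H₁} {δ₂ : DirectDerivation ρ₂ g₂ H₂} (ind : Independence δ₁ δ₂) →
             let open Independence ind in
             {D₁′ D₂′ M : Graph S} {i₁ : Hom (R ρ₁) D₁′} {j₁ : Hom N D₁′} {i₂ : Hom (R ρ₂) D₂′} {j₂ : Hom N D₂′}
             {x₁ : Hom D₁′ M} {x₂ : Hom D₂′ M} →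
             IsPushout (r ρ₁) k₁′ i₁ j₁ → IsPushout (r ρ₂) k₂′ i₂ j₂ → IsPushout j₁ j₂ x₁ x₂ →
             DirectDerivation ρ₂ (DD.e δ₁ ∘H g₂′) M
  residual {ρ₁} {ρ₂} {H₁ = H₁} {δ₁ = δ₁} {δ₂} ind {D₁′} {i₁ = i₁} {j₁} {i₂} {x₁ = x₁} {x₂} D₁′-po D₂′-po M-po = record
    { match-inj = ∘H-injective (DirectDerivation-e-injective δ₁) (∘H-injectiveʳ (DD.d δ₁) d₁g₂′≈g₂ (DD.match-inj δ₂))
    ; D = D₁′ ; k = j₁ ∘H k₂′ ; d = z₁ ; h = x₂ ∘H i₂ ; e = x₁
    ; po₁ = IsPushout-paste restricted (IsPushout-sym lower)
    ; po₂ = IsPushout-paste D₂′-po (IsPushout-sym M-po) }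
    where
    open Independence ind
    open ≈H-Reasoning
    hr₁≈e₁n₁k₁′ : DD.h δ₁ ∘H r ρ₁ ≈H DD.e δ₁ ∘H n₁ ∘H k₁′
    hr₁≈e₁n₁k₁′ = begin
      DD.h δ₁ ∘H r ρ₁         ≈⟨ IsPushout.commutes (DD.po₂ δ₁) ⟩
      DD.e δ₁ ∘H DD.k δ₁      ≈⟨ ∘H-congˡ (DD.e δ₁) n₁k₁′≈k₁ ⟨
      DD.e δ₁ ∘H n₁ ∘H k₁′    ∎
    open Mediator D₁′-po (DD.h δ₁) (DD.e δ₁ ∘H n₁) hr₁≈e₁n₁k₁′
      renaming (mediator to z₁; mediator-i to z₁i₁≈h₁; mediator-j to z₁j₁≈e₁n₁)
    lower : IsPushout j₁ n₁ z₁ (DD.e δ₁)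
    lower = IsPushout-cancel D₁′-po (DD.po₂ δ₁) n₁k₁′≈k₁ z₁i₁≈h₁ z₁j₁≈e₁n₁
    restricted : IsPushout (l ρ₂) k₂′ g₂′ n₁
    restricted = IsPushout-restrict common (l-inj ρ₂) (DD.match-inj δ₂) (DirectDerivation-d-injective δ₁) (DD.po₁ δ₂)
                                    d₁g₂′≈g₂ n₂k₂′≈k₂

  localChurchRosser : {ρ₁ ρ₂ : Rule {S}} {G H₁ H₂ : Graph S} {g₁ : Hom (L ρ₁) G} {g₂ : Hom (L ρ₂) G} →
                      ParallelIndependent ρ₁ ρ₂ g₁ g₂ → DirectDerivation ρ₁ g₁ H₁ → DirectDerivation ρ₂ g₂ H₂ →
                      Σ (Graph S) λ M → (Σ (Hom (L ρ₂) H₁) λ g₂″ → DirectDerivation ρ₂ g₂″ M)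
                                      × (Σ (Hom (L ρ₁) H₂) λ g₁″ → DirectDerivation ρ₁ g₁″ M)
  localChurchRosser {ρ₁} {ρ₂} independent δ₁ δ₂ =
    P M ,
    (_ , residual ind (isPushout D₁′) (isPushout D₂′) (isPushout M)) ,
    (_ , residual (Independence-sym ind) (isPushout D₂′) (isPushout D₁′) (IsPushout-sym (isPushout M)))
    where
    open Pushout
    ind : Independence δ₁ δ₂
    ind = parallelIndependent⇒Independence independent δ₁ δ₂
    open Independence ind using (k₁′; k₂′)
    D₁′ : Pushout (r ρ₁) k₁′
    D₁′ = pushout (r ρ₁) (r-inj ρ₁) k₁′
    D₂′ : Pushout (r ρ₂) k₂′
    D₂′ = pushout (r ρ₂) (r-inj ρ₂) k₂′
    M : Pushout (j D₁′) (j D₂′)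
    M = pushout (j D₁′) (j-injective D₁′) (j D₂′)

  ≈H? : {A B : Graph S} (f g : Hom A B) → Dec (f ≈H g)
  ≈H? f g = all? (λ v → hV f v ≟ᶠ hV g v) ×-dec all? (λ e → hE f e ≟ᶠ hE g e)

  parallelIndependent? : (ρ₁ ρ₂ : Rule {S}) {G : Graph S} (g₁ : Hom (L ρ₁) G) (g₂ : Hom (L ρ₂) G) →
                         Dec (ParallelIndependent ρ₁ ρ₂ g₁ g₂)
  parallelIndependent? ρ₁ ρ₂ g₁ g₂ =
    all? (λ v → img? (hV g₁) v →-dec img? (hV g₂) v →-dec
                (img? (hV (g₁ ∘H l ρ₁)) v ×-dec img? (hV (g₂ ∘H l ρ₂)) v)) ×-dec
    all? (λ e → img? (hE g₁) e →-dec img? (hE g₂) e →-dec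
                (img? (hE (g₁ ∘H l ρ₁)) e ×-dec img? (hE (g₂ ∘H l ρ₂)) e))

  ≅-refl : {H : Graph S} → H ≅ H
  ≅-refl = idH , idH , ≈H-refl , ≈H-refl

  image-closed : {X G : Graph S} (g : Hom X G) → ∀ e → InImgE g e → InImgV g (src G e) × InImgV g (tgt G e)
  image-closed {X} g _ (x , refl) = (src X x , src-pres g x) , (tgt X x , tgt-pres g x)

  Hat-subgraph : {𝒟 : Graph S → Set} {G G₀ : Graph S} (m : Hom G₀ G) → InjectiveH m → 𝒟 G → Hat 𝒟 G₀
  Hat-subgraph m m-inj G∈𝒟 P _ subgraph-closed 𝒟⊆P = subgraph-closed m m-inj (𝒟⊆P _ G∈𝒟)

-- Critical pairs

module _ (T : GTS) (𝒟 : Graph (GTS.sig T) → Set) where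
  open GTS T
  open Rule

  sameMatch? : {G : Graph sig} (i₁ i₂ : Fin n) (g₁ : Hom (L (rule i₁)) G) (g₂ : Hom (L (rule i₂)) G) →
               Dec (Σ (i₁ ≡ i₂) λ p → SameMatch T p g₁ g₂)
  sameMatch? i₁ i₂ g₁ g₂ with i₁ ≟ᶠ i₂
  ... | no i₁≢i₂ = no (i₁≢i₂ ∘ proj₁)
  ... | yes refl = map′ (refl ,_) (λ { (refl , g₁≈g₂) → g₁≈g₂ }) (≈H? g₁ g₂)

  dependent⇒sameMatch : NoNonGarbageCriticalPairs T 𝒟 → {G H₁ H₂ : Graph sig} → 𝒟 G →
                        (i₁ i₂ : Fin n) {g₁ : Hom (L (rule i₁)) G} {g₂ : Hom (L (rule i₂)) G} →
                        DirectDerivation (rule i₁) g₁ H₁ → DirectDerivation (rule i₂) g₂ H₂ →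
                        ¬ ParallelIndependent (rule i₁) (rule i₂) g₁ g₂ → Σ (i₁ ≡ i₂) λ p → SameMatch T p g₁ g₂
  dependent⇒sameMatch noCriticalPairs {G} G∈𝒟 i₁ i₂ {g₁} {g₂} δ₁ δ₂ dependent with sameMatch? i₁ i₂ g₁ g₂
  ... | yes same    = same
  ... | no distinct =
    ⊥-elim (noCriticalPairs i₁ i₂ g₁′ g₂′ (proj₂ δ₁′) (proj₂ δ₂′) critical (Hat-subgraph ι ι-injective G∈𝒟))
    where
    open InducedSubgraph (inducedSubgraph G
      (λ v → img? (hV g₁) v ⊎-dec img? (hV g₂) v) (λ e → img? (hE g₁) e ⊎-dec img? (hE g₂) e)
      (λ e → Sum.map (proj₁ ∘ image-closed g₁ e) (proj₁ ∘ image-closed g₂ e))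
      (λ e → Sum.map (proj₂ ∘ image-closed g₁ e) (proj₂ ∘ image-closed g₂ e)))
    g₁⊑ι : g₁ ⊑ ι
    g₁⊑ι = (λ a → ∈V⇒image _ (inj₁ (a , refl))) , (λ a → ∈E⇒image _ (inj₁ (a , refl)))
    g₂⊑ι : g₂ ⊑ ι
    g₂⊑ι = (λ a → ∈V⇒image _ (inj₂ (a , refl))) , (λ a → ∈E⇒image _ (inj₂ (a , refl)))
    g₁′ : Hom (L (rule i₁)) Sub
    g₁′ = factorThrough g₁ ι ι-injective g₁⊑ι
    g₂′ : Hom (L (rule i₂)) Sub
    g₂′ = factorThrough g₂ ι ι-injective g₂⊑ι
    ιg₁′≈g₁ : ι ∘H g₁′ ≈H g₁
    ιg₁′≈g₁ = factorThrough-commutes g₁ ι ι-injective g₁⊑ι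
    ιg₂′≈g₂ : ι ∘H g₂′ ≈H g₂
    ιg₂′≈g₂ = factorThrough-commutes g₂ ι ι-injective g₂⊑ι
    δ₁′ : Σ (Graph sig) (DirectDerivation (rule i₁) g₁′)
    δ₁′ = restrictDerivation δ₁ ι ι-injective g₁′ ιg₁′≈g₁
    δ₂′ : Σ (Graph sig) (DirectDerivation (rule i₂) g₂′)
    δ₂′ = restrictDerivation δ₂ ι ι-injective g₂′ ιg₂′≈g₂
    critical : IsCriticalPair T i₁ i₂ g₁′ g₂′ (proj₂ δ₁′) (proj₂ δ₂′)
    critical = record
      { not-independent = λ (indV , indE) → dependent
          ( independent-restrict (proj₁ ι-injective) (proj₁ ιg₁′≈g₁) (proj₁ ιg₂′≈g₂) indV
          , independent-restrict (proj₂ ι-injective) (proj₂ ιg₁′≈g₁) (proj₂ ιg₂′≈g₂) indE)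
      ; covers = (λ q → Sum.map (Img-cancel (proj₁ ι-injective) (proj₁ ιg₁′≈g₁) q)
                                (Img-cancel (proj₁ ι-injective) (proj₁ ιg₂′≈g₂) q) (ι-∈V q))
               , (λ q → Sum.map (Img-cancel (proj₂ ι-injective) (proj₂ ιg₁′≈g₁) q)
                                (Img-cancel (proj₂ ι-injective) (proj₂ ιg₂′≈g₂) q) (ι-∈E q))
      ; distinct = λ { refl g₁′≈g₂′ →
          distinct (refl , ≈H-trans (≈H-sym ιg₁′≈g₁) (≈H-trans (∘H-congˡ ι g₁′≈g₂′) ιg₂′≈g₂)) } }

mainTheorem15 : (T : GTS) (D : Graph (GTS.sig T) → Set) →
                IsoClosed D →
                NoNonGarbageCriticalPairs T D →
                SubcommutativeUpToGarbage T D
mainTheorem15 T D _ noCriticalPairs G G∈D H₁ H₂ (i₁ , g₁ , δ₁) (i₂ , g₂ , δ₂)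
  with parallelIndependent? (GTS.rule T i₁) (GTS.rule T i₂) g₁ g₂
... | yes independent =
  let (M , (g₂″ , δ₂″) , (g₁″ , δ₁″)) = localChurchRosser independent δ₁ δ₂
  in M , inj₂ (i₂ , g₂″ , δ₂″) , inj₂ (i₁ , g₁″ , δ₁″)
... | no dependent with dependent⇒sameMatch T D noCriticalPairs G∈D i₁ i₂ δ₁ δ₂ dependent
...   | refl , g₁≈g₂ = H₂ , inj₁ (derivation-unique g₁≈g₂ δ₁ δ₂) , inj₁ ≅-refl
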